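{- Let $A(q)=\prod_{j} f_j^{n_j}=:\sum_{n=0}^{\infty}a_nq^n$ be any eta quotient such that $n_1$ is odd and $n_j$ is even for every odd $j>1$, and let $B(q)=A(q)\frac{f_1^2f_2}{f_4}=:\sum_{n=0}^{\infty}b_nq^n$. Then for all $n\ge0$, \[ a_n\equiv 0\pmod 4 \iff b_n\equiv 0\pmod 4,\qquad a_n\equiv 2\pmod 4\iff b_n\equiv 2\pmod 4. \]
   Context: For $|q|<1$ and positive integers $j$, $f_j:=\prod_{n=1}^{\infty}(1-q^{jn})$. An eta quotient is a finite product $\prod_j f_j^{n_j}$ with $j\in\mathbb{N}$, $n_j\in\mathbb{Z}$. -}

module Defs where

open import Data.Nat as ℕ using (ℕ; zero; suc; _∸_)
open import Data.Nat.Divisibility as ℕD using (_∣?_)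
open import Data.Integer as ℤ using (ℤ; +_; -[1+_])
open import Data.Bool using (if_then_else_)
open import Relation.Nullary.Decidable using (⌊_⌋)
open import Relation.Nullary using (¬_)

PS : Set
PS = ℕ → ℤ

sumTo : ℕ → (ℕ → ℤ) → ℤ
sumTo zero g = g 0
sumTo (suc m) g = sumTo m g ℤ.+ g (suc m)

infixl 7 _⊛_
_⊛_ : PS → PS → PS
(a ⊛ b) m = sumTo m (λ k → a k ℤ.* b (m ∸ k))

𝟙 : PS
𝟙 zero = + 1
𝟙 (suc _) = + 0

mono : ℕ → PS
mono d m = if d ℕ.≡ᵇ m then + 1 else + 0

oneMinus : ℕ → PS
oneMinus d m = 𝟙 m ℤ.- mono d m

-- 1/(1 - q^d) = Σ_k q^{dk}   (used with d ≥ 1)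
geom : ℕ → PS
geom d m = if ⌊ d ∣? m ⌋ then + 1 else + 0

prodUpTo : ℕ → (ℕ → PS) → PS
prodUpTo zero F = 𝟙
prodUpTo (suc N) F = prodUpTo N F ⊛ F (suc N)

-- f_j = Π_{n≥1} (1 - q^{jn}); the coefficient of q^m only depends on
-- the factors with n ≤ m (for j ≥ 1), so we truncate there.
f : ℕ → PS
f j m = prodUpTo m (λ n → oneMinus (j ℕ.* n)) m

-- 1/f_j = Π_{n≥1} 1/(1 - q^{jn}), truncated in the same way.
finv : ℕ → PS
finv j m = prodUpTo m (λ n → geom (j ℕ.* n)) m

pow : PS → ℕ → PS
pow a zero = 𝟙
pow a (suc k) = pow a k ⊛ a

fpow : ℕ → ℤ → PS
fpow j (+ k) = pow (f j) k
fpow j -[1+ k ] = pow (finv j) (suc k)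

etaQuotient : ℕ → (ℕ → ℤ) → PS
etaQuotient N e = prodUpTo N (λ j → fpow j (e j))

OddNat : ℕ → Set
OddNat j = ¬ (2 ℕD.∣ j)

-- Let Φ = 1 + 2θ with θ = q d/dq. As (2θX)(2θY) ≡ 0 (mod 4), Φ is multiplicative modulo 4, and it fixes
-- squares and series in q² modulo 4. The parity hypotheses give A = f₁K with K a product of such series, so
-- Φ A ≡ K · Φ f₁. The heart of the proof is f₁ · f₁²f₂/f₄ ≡ Φ f₁ (mod 4): factor by factor,
-- (1 - x)²(1 - x²)/(1 - x⁴) ≡ 1 + 2x/(1 - x²) and Φ(1 - qⁿ) · (1 + 2[n odd] qⁿ/(1 - qⁿ)) ≡ 1 - qⁿ;
-- products of factors 1 + 2aₙ are 1 + 2Σaₙ modulo 4; and Σₙ qⁿ/(1 - q²ⁿ) = Σ_{n odd} qⁿ/(1 - qⁿ), as both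
-- count odd divisors. Hence B ≡ Φ A, that is bₙ ≡ (1 + 2n) aₙ (mod 4), and multiplication by the odd number
-- 1 + 2n is an involution modulo 4 fixing the residues 0 and 2.

module Submission where

open import Defs
open import Data.Nat as ℕ using (ℕ; zero; suc; _∸_)
import Data.Nat.Properties as ℕP
import Data.Nat.Divisibility as ℕD
open import Data.Nat.Primality using (euclidsLemma; prime[2])
open import Data.Nat.Induction using (<-rec)
import Data.Nat.Tactic.RingSolver as ℕSolver
open import Data.Integer as ℤ using (ℤ; +_; -[1+_]; _+_; _*_; -_; _-_)
import Data.Integer.Properties as ℤP
open import Data.Integer.Divisibility using (_∣_)
import Data.Integer.Divisibility.Signed as ℤD
open import Data.Integer.Tactic.RingSolver using (solve-∀)
open import Data.Empty using (⊥-elim)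
open import Data.Maybe using (Maybe; just; nothing)
open import Data.Product using (Σ; _×_; _,_)
open import Data.Sum using (inj₁; inj₂)
open import Function using (_∘_)
open import Function.Bundles using (_⇔_; mk⇔)
open import Level using (0ℓ)
open import Algebra.Bundles using (CommutativeRing)
import Algebra.Solver.Ring
import Algebra.Solver.Ring.AlmostCommutativeRing as ACR
open import Relation.Binary.Structures using (IsEquivalence)
open import Relation.Binary.Bundles using (Setoid)
import Relation.Binary.Reasoning.Setoid as SetoidReasoning
open import Relation.Nullary using (¬_; yes; no; contradiction; toSum)
open import Relation.Binary.PropositionalEquality
  using (_≡_; _≢_; refl; sym; trans; cong; cong₂; subst; subst₂; module ≡-Reasoning)

infixl 6 _⊕_
_⊕_ : PS → PS → PS
(a ⊕ b) m = a m + b m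

⊖_ : PS → PS
(⊖ a) m = - a m

0ˢ : PS
0ˢ _ = + 0

infixl 7 _·_
_·_ : ℤ → PS → PS
(c · a) m = c * a m

cst : ℤ → PS
cst c = c · 𝟙

1ˢ 2ˢ : PS
1ˢ = cst (+ 1)
2ˢ = cst (+ 2)

tail : PS → PS
tail a k = a (suc k)

sumTo-cong : ∀ m {g h : ℕ → ℤ} → (∀ k → k ℕ.≤ m → g k ≡ h k) → sumTo m g ≡ sumTo m h
sumTo-cong zero e = e 0 ℕ.z≤n
sumTo-cong (suc m) e =
  cong₂ _+_ (sumTo-cong m (λ k k≤m → e k (ℕP.m≤n⇒m≤1+n k≤m))) (e (suc m) ℕP.≤-refl)

sumTo-+ : ∀ m (g h : ℕ → ℤ) → sumTo m (λ k → g k + h k) ≡ sumTo m g + sumTo m h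
sumTo-+ zero g h = refl
sumTo-+ (suc m) g h = begin
  sumTo m (λ k → g k + h k) + (g (suc m) + h (suc m))
    ≡⟨ cong (_+ (g (suc m) + h (suc m))) (sumTo-+ m g h) ⟩
  (sumTo m g + sumTo m h) + (g (suc m) + h (suc m))
    ≡⟨ interchange (sumTo m g) (sumTo m h) (g (suc m)) (h (suc m)) ⟩
  (sumTo m g + g (suc m)) + (sumTo m h + h (suc m)) ∎
  where
  open ≡-Reasoning
  interchange : ∀ a b c d → (a + b) + (c + d) ≡ (a + c) + (b + d)
  interchange = solve-∀

sumTo-*ˡ : ∀ m c (g : ℕ → ℤ) → sumTo m (λ k → c * g k) ≡ c * sumTo m g
sumTo-*ˡ zero c g = refl
sumTo-*ˡ (suc m) c g = trans (cong (_+ c * g (suc m)) (sumTo-*ˡ m c g))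
  (sym (ℤP.*-distribˡ-+ c (sumTo m g) (g (suc m))))

sumTo-zero : ∀ m (g : ℕ → ℤ) → (∀ k → k ℕ.≤ m → g k ≡ + 0) → sumTo m g ≡ + 0
sumTo-zero m g e = trans (sumTo-cong m e) (zeros m)
  where
  zeros : ∀ m → sumTo m (λ _ → + 0) ≡ + 0
  zeros zero = refl
  zeros (suc m) = cong (_+ + 0) (zeros m)

sumTo-suc : ∀ m (g : ℕ → ℤ) → sumTo (suc m) g ≡ g 0 + sumTo m (g ∘ suc)
sumTo-suc zero g = refl
sumTo-suc (suc m) g = trans (cong (_+ g (suc (suc m))) (sumTo-suc m g))
  (ℤP.+-assoc (g 0) (sumTo m (g ∘ suc)) (g (suc (suc m))))

sumTo-single : ∀ m d (g : ℕ → ℤ) → (∀ k → k ≢ d → g k ≡ + 0) → d ℕ.≤ m → sumTo m g ≡ g d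
sumTo-single zero .zero g g-off ℕ.z≤n = refl
sumTo-single (suc m) d g g-off d≤1+m with suc m ℕ.≟ d
... | yes refl = trans (cong (_+ g (suc m)) (sumTo-zero m g (λ k k≤m → g-off k (ℕP.<⇒≢ (ℕ.s≤s k≤m)))))
                       (ℤP.+-identityˡ (g (suc m)))
... | no 1+m≢d = trans (cong₂ _+_ (sumTo-single m d g g-off (ℕ.s≤s⁻¹ (ℕP.≤∧≢⇒< d≤1+m (1+m≢d ∘ sym))))
                                  (g-off (suc m) 1+m≢d))
                       (ℤP.+-identityʳ (g d))

⊛-suc : ∀ m a b → (a ⊛ b) (suc m) ≡ a 0 * b (suc m) + (tail a ⊛ b) m
⊛-suc m a b = sumTo-suc m (λ k → a k * b (suc m ∸ k))

⊛-congˡ-≤ : ∀ m {a a′} b → (∀ k → k ℕ.≤ m → a k ≡ a′ k) → (a ⊛ b) m ≡ (a′ ⊛ b) m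
⊛-congˡ-≤ m b e = sumTo-cong m (λ k k≤m → cong (_* b (m ∸ k)) (e k k≤m))

⊛-congʳ-≤ : ∀ m a {b b′} → (∀ k → k ℕ.≤ m → b k ≡ b′ k) → (a ⊛ b) m ≡ (a ⊛ b′) m
⊛-congʳ-≤ m a e = sumTo-cong m (λ k _ → cong (a k *_) (e (m ∸ k) (ℕP.m∸n≤m m k)))

-- The last clause peels off the leading term on both sides, so every recursive call is at a smaller index.
⊛-comm : ∀ m a b → (a ⊛ b) m ≡ (b ⊛ a) m
⊛-comm zero a b = ℤP.*-comm (a 0) (b 0)
⊛-comm (suc zero) a b = swap (a 0) (a 1) (b 0) (b 1)
  where
  swap : ∀ a₀ a₁ b₀ b₁ → a₀ * b₁ + a₁ * b₀ ≡ b₀ * a₁ + b₁ * a₀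
  swap = solve-∀
⊛-comm (suc (suc m)) a b = begin
  (a ⊛ b) (2 ℕ.+ m)                   ≡⟨ ⊛-suc (suc m) a b ⟩
  x + (tail a ⊛ b) (suc m)            ≡⟨ cong (λ z → x + z) (⊛-comm (suc m) (tail a) b) ⟩
  x + (b ⊛ tail a) (suc m)            ≡⟨ cong (λ z → x + z) (⊛-suc m b (tail a)) ⟩
  x + (y + (tail b ⊛ tail a) m)       ≡⟨ cong (λ z → x + (y + z)) (⊛-comm m (tail b) (tail a)) ⟩
  x + (y + (tail a ⊛ tail b) m)       ≡⟨ exchange x y _ ⟩
  y + (x + (tail a ⊛ tail b) m)       ≡⟨ cong (λ z → y + z) (sym (⊛-suc m a (tail b))) ⟩
  y + (a ⊛ tail b) (suc m)            ≡⟨ cong (λ z → y + z) (⊛-comm (suc m) a (tail b)) ⟩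
  y + (tail b ⊛ a) (suc m)            ≡⟨ sym (⊛-suc (suc m) b a) ⟩
  (b ⊛ a) (2 ℕ.+ m) ∎
  where
  open ≡-Reasoning
  x = a 0 * b (2 ℕ.+ m)
  y = b 0 * a (2 ℕ.+ m)
  exchange : ∀ x y z → x + (y + z) ≡ y + (x + z)
  exchange = solve-∀

⊛-distribʳ : ∀ m a b c → ((a ⊕ b) ⊛ c) m ≡ (a ⊛ c) m + (b ⊛ c) m
⊛-distribʳ m a b c = trans (sumTo-cong m (λ k _ → ℤP.*-distribʳ-+ (c (m ∸ k)) (a k) (b k)))
  (sumTo-+ m (λ k → a k * c (m ∸ k)) (λ k → b k * c (m ∸ k)))

⊛-distribˡ : ∀ m a b c → (a ⊛ (b ⊕ c)) m ≡ (a ⊛ b) m + (a ⊛ c) m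
⊛-distribˡ m a b c = trans (sumTo-cong m (λ k _ → ℤP.*-distribˡ-+ (a k) (b (m ∸ k)) (c (m ∸ k))))
  (sumTo-+ m (λ k → a k * b (m ∸ k)) (λ k → a k * c (m ∸ k)))

·-⊛ : ∀ m s a c → ((s · a) ⊛ c) m ≡ s * (a ⊛ c) m
·-⊛ m s a c = trans (sumTo-cong m (λ k _ → ℤP.*-assoc s (a k) (c (m ∸ k))))
  (sumTo-*ˡ m s (λ k → a k * c (m ∸ k)))

⊛-identityˡ : ∀ m a → (𝟙 ⊛ a) m ≡ a m
⊛-identityˡ zero a = ℤP.*-identityˡ (a 0)
⊛-identityˡ (suc m) a = begin
  (𝟙 ⊛ a) (suc m)                  ≡⟨ ⊛-suc m 𝟙 a ⟩
  + 1 * a (suc m) + (0ˢ ⊛ a) m     ≡⟨ cong (λ z → + 1 * a (suc m) + z) (sumTo-zero m _ (λ k _ → refl)) ⟩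
  + 1 * a (suc m) + + 0            ≡⟨ ℤP.+-identityʳ _ ⟩
  + 1 * a (suc m)                  ≡⟨ ℤP.*-identityˡ _ ⟩
  a (suc m) ∎
  where open ≡-Reasoning

⊛-assoc : ∀ m a b c → ((a ⊛ b) ⊛ c) m ≡ (a ⊛ (b ⊛ c)) m
⊛-assoc zero a b c = ℤP.*-assoc (a 0) (b 0) (c 0)
⊛-assoc (suc m) a b c = begin
  ((a ⊛ b) ⊛ c) (suc m)
    ≡⟨ ⊛-suc m (a ⊛ b) c ⟩
  a 0 * b 0 * c (suc m) + (tail (a ⊛ b) ⊛ c) m
    ≡⟨ cong (λ z → a 0 * b 0 * c (suc m) + z) (⊛-congˡ-≤ m c (λ k _ → ⊛-suc k a b)) ⟩
  a 0 * b 0 * c (suc m) + (((a 0 · tail b) ⊕ (tail a ⊛ b)) ⊛ c) m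
    ≡⟨ cong (λ z → a 0 * b 0 * c (suc m) + z) (⊛-distribʳ m (a 0 · tail b) (tail a ⊛ b) c) ⟩
  a 0 * b 0 * c (suc m) + (((a 0 · tail b) ⊛ c) m + ((tail a ⊛ b) ⊛ c) m)
    ≡⟨ cong₂ (λ u v → (a 0 * b 0 * c (suc m)) + (u + v)) (·-⊛ m (a 0) (tail b) c) (⊛-assoc m (tail a) b c) ⟩
  a 0 * b 0 * c (suc m) + (a 0 * (tail b ⊛ c) m + (tail a ⊛ (b ⊛ c)) m)
    ≡⟨ regroup (a 0) (b 0) (c (suc m)) ((tail b ⊛ c) m) ((tail a ⊛ (b ⊛ c)) m) ⟩
  a 0 * (b 0 * c (suc m) + (tail b ⊛ c) m) + (tail a ⊛ (b ⊛ c)) m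
    ≡⟨ cong (λ u → a 0 * u + (tail a ⊛ (b ⊛ c)) m) (sym (⊛-suc m b c)) ⟩
  a 0 * (b ⊛ c) (suc m) + (tail a ⊛ (b ⊛ c)) m
    ≡⟨ sym (⊛-suc m a (b ⊛ c)) ⟩
  (a ⊛ (b ⊛ c)) (suc m) ∎
  where
  open ≡-Reasoning
  regroup : ∀ a₀ b₀ c u v → a₀ * b₀ * c + (a₀ * u + v) ≡ a₀ * (b₀ * c + u) + v
  regroup = solve-∀

-- Coefficientwise equality, wrapped in a record so that the ring solver can infer both sides.
infix 4 _≈_
record _≈_ (a b : PS) : Set where
  constructor mk≈
  field at : ∀ m → a m ≡ b m
open _≈_ public

≈-refl : ∀ {a} → a ≈ a
≈-refl = mk≈ (λ _ → refl)

≈-reflexive : ∀ {a b} → a ≡ b → a ≈ b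
≈-reflexive refl = ≈-refl

≈-sym : ∀ {a b} → a ≈ b → b ≈ a
≈-sym e = mk≈ (λ m → sym (at e m))

≈-trans : ∀ {a b c} → a ≈ b → b ≈ c → a ≈ c
≈-trans e e′ = mk≈ (λ m → trans (at e m) (at e′ m))

⊕-cong : ∀ {a a′ b b′} → a ≈ a′ → b ≈ b′ → a ⊕ b ≈ a′ ⊕ b′
⊕-cong e e′ = mk≈ (λ m → cong₂ _+_ (at e m) (at e′ m))

⊕-congˡ : ∀ a {b b′} → b ≈ b′ → a ⊕ b ≈ a ⊕ b′
⊕-congˡ a = ⊕-cong {a} ≈-refl

⊕-congʳ : ∀ b {a a′} → a ≈ a′ → a ⊕ b ≈ a′ ⊕ b
⊕-congʳ b e = ⊕-cong {b = b} e ≈-refl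

⊖-cong : ∀ {a a′} → a ≈ a′ → ⊖ a ≈ ⊖ a′
⊖-cong e = mk≈ (λ m → cong -_ (at e m))

⊛-cong : ∀ {a a′ b b′} → a ≈ a′ → b ≈ b′ → a ⊛ b ≈ a′ ⊛ b′
⊛-cong e e′ = mk≈ (λ m → sumTo-cong m (λ k _ → cong₂ _*_ (at e k) (at e′ (m ∸ k))))

⊛-congˡ : ∀ a {b b′} → b ≈ b′ → a ⊛ b ≈ a ⊛ b′
⊛-congˡ a = ⊛-cong {a} {a} ≈-refl

⊛-congʳ : ∀ b {a a′} → a ≈ a′ → a ⊛ b ≈ a′ ⊛ b
⊛-congʳ b e = ⊛-cong {b = b} {b} e ≈-refl

PS-commutativeRing : CommutativeRing 0ℓ 0ℓ
PS-commutativeRing = record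
  { Carrier = PS ; _≈_ = _≈_ ; _+_ = _⊕_ ; _*_ = _⊛_ ; -_ = ⊖_ ; 0# = 0ˢ ; 1# = 𝟙
  ; isCommutativeRing = record
    { isRing = record
      { +-isAbelianGroup = record
        { isGroup = record
          { isMonoid = record
            { isSemigroup = record
              { isMagma = record { isEquivalence = ≈-isEquivalence ; ∙-cong = ⊕-cong }
              ; assoc = λ a b c → mk≈ (λ m → ℤP.+-assoc (a m) (b m) (c m)) }
            ; identity = (λ a → mk≈ (λ m → ℤP.+-identityˡ (a m)))
                       , (λ a → mk≈ (λ m → ℤP.+-identityʳ (a m))) }
          ; inverse = (λ a → mk≈ (λ m → ℤP.+-inverseˡ (a m)))
                    , (λ a → mk≈ (λ m → ℤP.+-inverseʳ (a m)))
          ; ⁻¹-cong = ⊖-cong }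
        ; comm = λ a b → mk≈ (λ m → ℤP.+-comm (a m) (b m)) }
      ; *-cong = ⊛-cong
      ; *-assoc = λ a b c → mk≈ (λ m → ⊛-assoc m a b c)
      ; *-identity = (λ a → mk≈ (λ m → ⊛-identityˡ m a))
                   , (λ a → mk≈ (λ m → trans (⊛-comm m a 𝟙) (⊛-identityˡ m a)))
      ; distrib = (λ a b c → mk≈ (λ m → ⊛-distribˡ m a b c))
                , (λ a b c → mk≈ (λ m → ⊛-distribʳ m b c a)) }
    ; *-comm = λ a b → mk≈ (λ m → ⊛-comm m a b) }
  }
  where
  ≈-isEquivalence : IsEquivalence _≈_
  ≈-isEquivalence = record { refl = ≈-refl ; sym = ≈-sym ; trans = ≈-trans }

·≈cst⊛ : ∀ c X → c · X ≈ cst c ⊛ X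
·≈cst⊛ c X = mk≈ (λ m → sym (trans (·-⊛ m c 𝟙 X) (cong (c *_) (⊛-identityˡ m X))))

cst-+ : ∀ c d → cst (c + d) ≈ cst c ⊕ cst d
cst-+ c d = mk≈ (λ m → ℤP.*-distribʳ-+ (𝟙 m) c d)

cst-* : ∀ c d → cst (c * d) ≈ cst c ⊛ cst d
cst-* c d = ≈-trans (mk≈ (λ m → ℤP.*-assoc c d (𝟙 m))) (·≈cst⊛ c (cst d))

cst-homomorphism : ACR._-Raw-AlmostCommutative⟶_ ℤ.+-*-rawRing (ACR.fromCommutativeRing PS-commutativeRing)
cst-homomorphism = record
  { ⟦_⟧ = cst
  ; +-homo = cst-+
  ; *-homo = cst-*
  ; -‿homo = λ c → mk≈ (λ m → sym (ℤP.neg-distribˡ-* c (𝟙 m)))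
  ; 0-homo = mk≈ (λ m → ℤP.*-zeroˡ (𝟙 m))
  ; 1-homo = mk≈ (λ m → ℤP.*-identityˡ (𝟙 m))
  }

cst-≟ : ∀ c d → Maybe (cst c ≈ cst d)
cst-≟ c d with c ℤ.≟ d
... | yes refl = just ≈-refl
... | no _ = nothing

open Algebra.Solver.Ring ℤ.+-*-rawRing (ACR.fromCommutativeRing PS-commutativeRing) cst-homomorphism cst-≟
  using (solve; _:=_; _:+_; _:*_; :-_; con)

-- Congruences modulo k

infix 4 _∣ˢ_ _≡_mod_
record _∣ˢ_ (k : ℕ) (X : PS) : Set where
  constructor mk∣ˢ
  field ∣-at : ∀ m → + k ℤD.∣ X m
open _∣ˢ_ public

∣ˢ-resp-≈ : ∀ {k X Y} → X ≈ Y → k ∣ˢ X → k ∣ˢ Y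
∣ˢ-resp-≈ {k} e d = mk∣ˢ (λ m → subst (+ k ℤD.∣_) (at e m) (∣-at d m))

∣ˢ-⊕ : ∀ {k X Y} → k ∣ˢ X → k ∣ˢ Y → k ∣ˢ X ⊕ Y
∣ˢ-⊕ d d′ = mk∣ˢ (λ m → ℤD.∣m∣n⇒∣m+n (∣-at d m) (∣-at d′ m))

∣ˢ-⊖ : ∀ {k X} → k ∣ˢ X → k ∣ˢ ⊖ X
∣ˢ-⊖ d = mk∣ˢ (λ m → ℤD.∣m⇒∣-m (∣-at d m))

∣-sumTo : ∀ {k} m (g : ℕ → ℤ) → (∀ i → k ℤD.∣ g i) → k ℤD.∣ sumTo m g
∣-sumTo zero g d = d 0
∣-sumTo (suc m) g d = ℤD.∣m∣n⇒∣m+n (∣-sumTo m g d) (d (suc m))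

∣ˢ-⊛ˡ : ∀ {k X} Y → k ∣ˢ X → k ∣ˢ X ⊛ Y
∣ˢ-⊛ˡ Y d = mk∣ˢ (λ m → ∣-sumTo m _ (λ i → ℤD.∣m⇒∣m*n (Y (m ∸ i)) (∣-at d i)))

∣ˢ-⊛ʳ : ∀ {k} X {Y} → k ∣ˢ Y → k ∣ˢ X ⊛ Y
∣ˢ-⊛ʳ X d = mk∣ˢ (λ m → ∣-sumTo m _ (λ i → ℤD.∣n⇒∣m*n (X i) (∣-at d (m ∸ i))))

∣ˢ-cst⊛ : ∀ k X → k ∣ˢ cst (+ k) ⊛ X
∣ˢ-cst⊛ k X = ∣ˢ-resp-≈ (·≈cst⊛ (+ k) X) (mk∣ˢ (λ m → ℤD.divides (X m) (ℤP.*-comm (+ k) (X m))))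

record _≡_mod_ (X Y : PS) (k : ℕ) : Set where
  constructor mk≡mod
  field ∣-difference : k ∣ˢ X ⊕ ⊖ Y
open _≡_mod_ public

≈+multiple⇒≡mod : ∀ k {X Y} W → X ≈ Y ⊕ cst (+ k) ⊛ W → X ≡ Y mod k
≈+multiple⇒≡mod k {X} {Y} W e = mk≡mod (∣ˢ-resp-≈ difference (∣ˢ-cst⊛ k W))
  where
  difference : cst (+ k) ⊛ W ≈ X ⊕ ⊖ Y
  difference = ≈-sym (≈-trans (⊕-congʳ (⊖ Y) e)
    (solve 3 (λ Y c W → Y :+ c :* W :+ :- Y := c :* W) ≈-refl Y (cst (+ k)) W))

≈⇒≡mod : ∀ {k X Y} → X ≈ Y → X ≡ Y mod k
≈⇒≡mod {k} {X} {Y} e = ≈+multiple⇒≡mod k 0ˢ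
  (≈-trans e (solve 2 (λ Y c → Y := Y :+ c :* con (+ 0)) ≈-refl Y (cst (+ k))))

≡mod-refl : ∀ {k X} → X ≡ X mod k
≡mod-refl = ≈⇒≡mod ≈-refl

≡mod-sym : ∀ {k X Y} → X ≡ Y mod k → Y ≡ X mod k
≡mod-sym {X = X} {Y} (mk≡mod d) =
  mk≡mod (∣ˢ-resp-≈ (solve 2 (λ X Y → :- (X :+ :- Y) := Y :+ :- X) ≈-refl X Y) (∣ˢ-⊖ d))

≡mod-trans : ∀ {k X Y Z} → X ≡ Y mod k → Y ≡ Z mod k → X ≡ Z mod k
≡mod-trans {X = X} {Y} {Z} (mk≡mod d) (mk≡mod d′) =
  mk≡mod (∣ˢ-resp-≈ (solve 3 (λ X Y Z → (X :+ :- Y) :+ (Y :+ :- Z) := X :+ :- Z) ≈-refl X Y Z) (∣ˢ-⊕ d d′))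

≡mod-⊛ : ∀ {k X X′ Y Y′} → X ≡ X′ mod k → Y ≡ Y′ mod k → X ⊛ Y ≡ X′ ⊛ Y′ mod k
≡mod-⊛ {X = X} {X′} {Y} {Y′} (mk≡mod d) (mk≡mod d′) = mk≡mod (∣ˢ-resp-≈
  (solve 4 (λ X X′ Y Y′ → (X :+ :- X′) :* Y :+ X′ :* (Y :+ :- Y′) := X :* Y :+ :- (X′ :* Y′)) ≈-refl X X′ Y Y′)
  (∣ˢ-⊕ (∣ˢ-⊛ˡ Y d) (∣ˢ-⊛ʳ X′ d′)))

≡mod-setoid : ℕ → Setoid 0ℓ 0ℓ
≡mod-setoid k = record
  { Carrier = PS ; _≈_ = _≡_mod k
  ; isEquivalence = record { refl = ≡mod-refl ; sym = ≡mod-sym ; trans = ≡mod-trans } }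

module ≡mod-Reasoning (k : ℕ) = SetoidReasoning (≡mod-setoid k)

-- Infinite products

-- Π F = F 1 ⊛ F 2 ⊛ ⋯, with the coefficient of qᵐ taken from the partial product up to F m.
Π : (ℕ → PS) → PS
Π F m = prodUpTo m F m

infix 4 _≡𝟙-below_
_≡𝟙-below_ : PS → ℕ → Set
X ≡𝟙-below n = ∀ m → m ℕ.< n → X m ≡ 𝟙 m

-- F n = 1 + O(qⁿ), which makes the truncation in Π harmless.
Convergent : (ℕ → PS) → Set
Convergent F = ∀ n → F n ≡𝟙-below n

≡𝟙-below-⊛ : ∀ {n X Y} → X ≡𝟙-below n → Y ≡𝟙-below n → X ⊛ Y ≡𝟙-below n
≡𝟙-below-⊛ {n} {X} {Y} x≡𝟙 y≡𝟙 m m<n =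
  trans (⊛-congˡ-≤ m Y (λ k k≤m → x≡𝟙 k (ℕP.≤-<-trans k≤m m<n)))
  (trans (⊛-congʳ-≤ m 𝟙 (λ k k≤m → y≡𝟙 k (ℕP.≤-<-trans k≤m m<n))) (⊛-identityˡ m 𝟙))

Convergent-⊛ : ∀ {F G} → Convergent F → Convergent G → Convergent (λ n → F n ⊛ G n)
Convergent-⊛ cF cG n = ≡𝟙-below-⊛ (cF n) (cG n)

prodUpTo-stable : ∀ {F} → Convergent F → ∀ d m → prodUpTo (d ℕ.+ m) F m ≡ prodUpTo m F m
prodUpTo-stable cF zero m = refl
prodUpTo-stable {F} cF (suc d) m = begin
  (prodUpTo (d ℕ.+ m) F ⊛ F (suc (d ℕ.+ m))) m
    ≡⟨ ⊛-congʳ-≤ m (prodUpTo (d ℕ.+ m) F) (λ k k≤m → cF (suc (d ℕ.+ m)) k (ℕ.s≤s (ℕP.≤-trans k≤m (ℕP.m≤n+m m d)))) ⟩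
  (prodUpTo (d ℕ.+ m) F ⊛ 𝟙) m
    ≡⟨ ⊛-comm m (prodUpTo (d ℕ.+ m) F) 𝟙 ⟩
  (𝟙 ⊛ prodUpTo (d ℕ.+ m) F) m
    ≡⟨ ⊛-identityˡ m (prodUpTo (d ℕ.+ m) F) ⟩
  prodUpTo (d ℕ.+ m) F m
    ≡⟨ prodUpTo-stable cF d m ⟩
  prodUpTo m F m ∎
  where open ≡-Reasoning

prodUpTo≡Π : ∀ {F} → Convergent F → ∀ {m M} → m ℕ.≤ M → prodUpTo M F m ≡ Π F m
prodUpTo≡Π {F} cF {m} {M} m≤M =
  trans (cong (λ N → prodUpTo N F m) (sym (ℕP.m∸n+n≡m m≤M))) (prodUpTo-stable cF (M ∸ m) m)

prodUpTo-⊛ : ∀ (F G : ℕ → PS) N → prodUpTo N (λ n → F n ⊛ G n) ≈ prodUpTo N F ⊛ prodUpTo N G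
prodUpTo-⊛ F G zero = mk≈ (λ m → sym (⊛-identityˡ m 𝟙))
prodUpTo-⊛ F G (suc N) = ≈-trans (⊛-congʳ (F (suc N) ⊛ G (suc N)) (prodUpTo-⊛ F G N))
  (solve 4 (λ a b c d → (a :* b) :* (c :* d) := (a :* c) :* (b :* d)) ≈-refl
     (prodUpTo N F) (prodUpTo N G) (F (suc N)) (G (suc N)))

Π-⊛ : ∀ {F G} → Convergent F → Convergent G → Π (λ n → F n ⊛ G n) ≈ Π F ⊛ Π G
Π-⊛ {F} {G} cF cG = mk≈ λ m → trans (at (prodUpTo-⊛ F G m) m)
  (trans (⊛-congˡ-≤ m (prodUpTo m G) (λ k k≤m → prodUpTo≡Π cF k≤m))
         (⊛-congʳ-≤ m (Π F) (λ k k≤m → prodUpTo≡Π cG k≤m)))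

prodUpTo-cong : ∀ {F G} → (∀ n → F (suc n) ≈ G (suc n)) → ∀ N → prodUpTo N F ≈ prodUpTo N G
prodUpTo-cong e zero = ≈-refl
prodUpTo-cong e (suc N) = ⊛-cong (prodUpTo-cong e N) (e N)

Π-cong : ∀ {F G} → (∀ n → F (suc n) ≈ G (suc n)) → Π F ≈ Π G
Π-cong e = mk≈ (λ m → at (prodUpTo-cong e m) m)

prodUpTo-≡mod : ∀ {k F G} → (∀ n → F (suc n) ≡ G (suc n) mod k) → ∀ N → prodUpTo N F ≡ prodUpTo N G mod k
prodUpTo-≡mod e zero = ≡mod-refl
prodUpTo-≡mod e (suc N) = ≡mod-⊛ (prodUpTo-≡mod e N) (e N)

Π-≡mod : ∀ {k F G} → (∀ n → F (suc n) ≡ G (suc n) mod k) → Π F ≡ Π G mod k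
Π-≡mod e = mk≡mod (mk∣ˢ λ m → ∣-at (∣-difference (prodUpTo-≡mod e m)) m)

Π-𝟙 : Π (λ _ → 𝟙) ≈ 𝟙
Π-𝟙 = mk≈ (λ m → at (prodUpTo-𝟙 m) m)
  where
  prodUpTo-𝟙 : ∀ N → prodUpTo N (λ _ → 𝟙) ≈ 𝟙
  prodUpTo-𝟙 zero = ≈-refl
  prodUpTo-𝟙 (suc N) = ≈-trans (⊛-congʳ 𝟙 (prodUpTo-𝟙 N)) (mk≈ (λ m → ⊛-identityˡ m 𝟙))

-- The operator Φ = 1 + 2θ, where θ = q d/dq

θ : PS → PS
θ X m = + m * X m

Φ : PS → PS
Φ X = X ⊕ + 2 · θ X

Φ≈ : ∀ X → Φ X ≈ X ⊕ 2ˢ ⊛ θ X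
Φ≈ X = ⊕-congˡ X (·≈cst⊛ (+ 2) (θ X))

Φ-cong : ∀ {X Y} → X ≈ Y → Φ X ≈ Φ Y
Φ-cong e = mk≈ λ m → cong (λ z → z + + 2 * (+ m * z)) (at e m)

θ-⊛ : ∀ X Y → θ (X ⊛ Y) ≈ θ X ⊛ Y ⊕ X ⊛ θ Y
θ-⊛ X Y = mk≈ λ m → trans (sym (sumTo-*ˡ m (+ m) (λ k → X k * Y (m ∸ k))))
  (trans (sumTo-cong m (λ k k≤m → trans (cong (λ z → z * (X k * Y (m ∸ k))) (m≡k+[m∸k] k≤m))
                                         (leibniz (+ k) (+ (m ∸ k)) (X k) (Y (m ∸ k)))))
         (sumTo-+ m (λ k → + k * X k * Y (m ∸ k)) (λ k → X k * (+ (m ∸ k) * Y (m ∸ k)))))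
  where
  m≡k+[m∸k] : ∀ {k m} → k ℕ.≤ m → + m ≡ + k + + (m ∸ k)
  m≡k+[m∸k] {k} {m} k≤m = trans (cong +_ (sym (ℕP.m+[n∸m]≡n k≤m))) (ℤP.pos-+ k (m ∸ k))
  leibniz : ∀ a b x y → (a + b) * (x * y) ≡ a * x * y + x * (b * y)
  leibniz = solve-∀

Φ-⊛ : ∀ X Y → Φ (X ⊛ Y) ≡ Φ X ⊛ Φ Y mod 4
Φ-⊛ X Y = ≈+multiple⇒≡mod 4 (⊖ (θ X ⊛ θ Y)) (≈-trans (Φ≈ (X ⊛ Y))
  (≈-trans (⊕-congˡ (X ⊛ Y) (⊛-congˡ 2ˢ (θ-⊛ X Y)))
  (≈-trans (solve 4 (λ X Y θX θY → X :* Y :+ con (+ 2) :* (θX :* Y :+ X :* θY)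
                 := (X :+ con (+ 2) :* θX) :* (Y :+ con (+ 2) :* θY) :+ con (+ 4) :* (:- (θX :* θY)))
                 ≈-refl X Y (θ X) (θ Y))
           (⊕-congʳ (cst (+ 4) ⊛ ⊖ (θ X ⊛ θ Y)) (⊛-cong (≈-sym (Φ≈ X)) (≈-sym (Φ≈ Y)))))))

θ-𝟙 : θ 𝟙 ≈ 0ˢ
θ-𝟙 = mk≈ λ { zero → refl ; (suc m) → ℤP.*-zeroʳ (+ suc m) }

Φ-𝟙 : Φ 𝟙 ≈ 𝟙
Φ-𝟙 = mk≈ (λ m → trans (cong (λ z → 𝟙 m + + 2 * z) (at θ-𝟙 m)) (ℤP.+-identityʳ (𝟙 m)))

Π-Φ : ∀ F → Φ (Π F) ≡ Π (Φ ∘ F) mod 4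
Π-Φ F = mk≡mod (mk∣ˢ λ m → ∣-at (∣-difference (prodUpTo-Φ m)) m)
  where
  prodUpTo-Φ : ∀ N → Φ (prodUpTo N F) ≡ prodUpTo N (Φ ∘ F) mod 4
  prodUpTo-Φ zero = ≈⇒≡mod Φ-𝟙
  prodUpTo-Φ (suc N) = ≡mod-trans (Φ-⊛ (prodUpTo N F) (F (suc N))) (≡mod-⊛ (prodUpTo-Φ N) (≡mod-refl {X = Φ (F (suc N))}))

≡𝟙-below-Φ : ∀ {n X} → X ≡𝟙-below n → Φ X ≡𝟙-below n
≡𝟙-below-Φ {n} {X} x≡𝟙 m m<n = begin
  X m + + 2 * (+ m * X m)   ≡⟨ cong (λ z → z + + 2 * (+ m * z)) (x≡𝟙 m m<n) ⟩
  Φ 𝟙 m                     ≡⟨ at Φ-𝟙 m ⟩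
  𝟙 m ∎
  where open ≡-Reasoning

𝟙≈1ˢ : 𝟙 ≈ 1ˢ
𝟙≈1ˢ = mk≈ (λ m → sym (ℤP.*-identityˡ (𝟙 m)))

mono-diag : ∀ d → mono d d ≡ + 1
mono-diag zero = refl
mono-diag (suc d) = mono-diag d

mono-off : ∀ d k → k ≢ d → mono d k ≡ + 0
mono-off zero zero k≢d = ⊥-elim (k≢d refl)
mono-off zero (suc k) _ = refl
mono-off (suc d) zero _ = refl
mono-off (suc d) (suc k) k≢d = mono-off d k (k≢d ∘ cong suc)

mono-+ : ∀ a b j → mono (a ℕ.+ b) (a ℕ.+ j) ≡ mono b j
mono-+ zero b j = refl
mono-+ (suc a) b j = mono-+ a b j

data SplitAt (d m : ℕ) : Set where
  below : m ℕ.< d → SplitAt d m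
  above : ∀ j → m ≡ d ℕ.+ j → SplitAt d m

splitAt : ∀ d m → SplitAt d m
splitAt d m with m ℕ.<? d
... | yes m<d = below m<d
... | no m≮d = above (m ∸ d) (sym (ℕP.m+[n∸m]≡n (ℕP.≮⇒≥ m≮d)))

mono⊛-off : ∀ d (X : PS) m k → k ≢ d → mono d k * X (m ∸ k) ≡ + 0
mono⊛-off d X m k k≢d = trans (cong (λ z → z * X (m ∸ k)) (mono-off d k k≢d)) (ℤP.*-zeroˡ (X (m ∸ k)))

mono⊛-below : ∀ d (X : PS) m → m ℕ.< d → (mono d ⊛ X) m ≡ + 0
mono⊛-below d X m m<d =
  sumTo-zero m (λ k → mono d k * X (m ∸ k)) (λ k k≤m → mono⊛-off d X m k (ℕP.<⇒≢ (ℕP.≤-<-trans k≤m m<d)))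

mono⊛-above : ∀ d (X : PS) j → (mono d ⊛ X) (d ℕ.+ j) ≡ X j
mono⊛-above d X j = begin
  (mono d ⊛ X) (d ℕ.+ j)        ≡⟨ sumTo-single (d ℕ.+ j) d (λ k → mono d k * X (d ℕ.+ j ∸ k)) (mono⊛-off d X (d ℕ.+ j)) (ℕP.m≤m+n d j) ⟩
  mono d d * X (d ℕ.+ j ∸ d)    ≡⟨ cong₂ _*_ (mono-diag d) (cong X (ℕP.m+n∸m≡n d j)) ⟩
  + 1 * X j                     ≡⟨ ℤP.*-identityˡ (X j) ⟩
  X j ∎
  where open ≡-Reasoning

mono-⊛ : ∀ a b → mono a ⊛ mono b ≈ mono (a ℕ.+ b)
mono-⊛ a b = mk≈ λ m → go m (splitAt a m)
  where
  go : ∀ m → SplitAt a m → (mono a ⊛ mono b) m ≡ mono (a ℕ.+ b) m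
  go m (below m<a) = trans (mono⊛-below a (mono b) m m<a)
    (sym (mono-off (a ℕ.+ b) m (ℕP.<⇒≢ (ℕP.<-≤-trans m<a (ℕP.m≤m+n a b)))))
  go .(a ℕ.+ j) (above j refl) = trans (mono⊛-above a (mono b) j) (sym (mono-+ a b j))

θ-mono : ∀ d → θ (mono d) ≈ cst (+ d) ⊛ mono d
θ-mono d = ≈-trans (mk≈ θ-mono-at) (·≈cst⊛ (+ d) (mono d))
  where
  θ-mono-at : ∀ m → + m * mono d m ≡ + d * mono d m
  θ-mono-at m with m ℕ.≟ d
  ... | yes refl = refl
  ... | no m≢d = trans (cong (λ z → + m * z) (mono-off d m m≢d))
                       (trans (ℤP.*-zeroʳ (+ m)) (sym (trans (cong (λ z → + d * z) (mono-off d m m≢d)) (ℤP.*-zeroʳ (+ d)))))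

geom-∣ : ∀ {d m} → d ℕD.∣ m → geom d m ≡ + 1
geom-∣ {d} {m} d∣m with d ℕD.∣? m
... | yes _ = refl
... | no d∤m = ⊥-elim (d∤m d∣m)

geom-∤ : ∀ {d m} → ¬ d ℕD.∣ m → geom d m ≡ + 0
geom-∤ {d} {m} d∤m with d ℕD.∣? m
... | yes d∣m = ⊥-elim (d∤m d∣m)
... | no _ = refl

geom-cong : ∀ {d m d′ m′} → (d ℕD.∣ m → d′ ℕD.∣ m′) → (d′ ℕD.∣ m′ → d ℕD.∣ m) → geom d m ≡ geom d′ m′
geom-cong {d} {m} to from with d ℕD.∣? m
... | yes d∣m = sym (geom-∣ (to d∣m))
... | no d∤m = sym (geom-∤ (d∤m ∘ from))

geom-periodic : ∀ d j → geom d (d ℕ.+ j) ≡ geom d j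
geom-periodic d j = geom-cong (λ d∣d+j → ℕD.∣m+n∣m⇒∣n d∣d+j ℕD.∣-refl) (ℕD.∣m∣n⇒∣m+n ℕD.∣-refl)

oneMinus≈ : ∀ d → oneMinus d ≈ 1ˢ ⊕ ⊖ mono d
oneMinus≈ d = ⊕-congʳ (⊖ mono d) 𝟙≈1ˢ

geom-below : ∀ {d m} → m ℕ.< d → geom d m ≡ 𝟙 m
geom-below {d} {zero} _ = geom-∣ (ℕD._∣0 d)
geom-below {d} {suc m} 1+m<d = geom-∤ (λ d∣1+m → ℕP.<⇒≱ 1+m<d (ℕD.∣⇒≤ d∣1+m))

oneMinus⊛geom : ∀ d .{{_ : ℕ.NonZero d}} → oneMinus d ⊛ geom d ≈ 1ˢ
oneMinus⊛geom d = ≈-trans (⊛-congʳ (geom d) (oneMinus≈ d))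
  (≈-trans (solve 2 (λ x G → (con (+ 1) :+ :- x) :* G := G :+ :- (x :* G)) ≈-refl (mono d) (geom d))
  (≈-trans (mk≈ λ m → go m (splitAt d m)) 𝟙≈1ˢ))
  where
  𝟙-above : ∀ d .{{_ : ℕ.NonZero d}} j → 𝟙 (d ℕ.+ j) ≡ + 0
  𝟙-above (suc _) j = refl
  go : ∀ m → SplitAt d m → geom d m - (mono d ⊛ geom d) m ≡ 𝟙 m
  go m (below m<d) = trans (cong₂ _-_ (geom-below m<d) (mono⊛-below d (geom d) m m<d)) (ℤP.+-identityʳ (𝟙 m))
  go .(d ℕ.+ j) (above j refl) = trans (cong₂ _-_ (geom-periodic d j) (mono⊛-above d (geom d) j))
    (trans (ℤP.+-inverseʳ (geom d j)) (sym (𝟙-above d j)))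

≡𝟙-below-≤ : ∀ {n n′ X} → n ℕ.≤ n′ → X ≡𝟙-below n′ → X ≡𝟙-below n
≡𝟙-below-≤ n≤n′ x≡𝟙 m m<n = x≡𝟙 m (ℕP.<-≤-trans m<n n≤n′)

oneMinus-≡𝟙-below : ∀ d → oneMinus d ≡𝟙-below d
oneMinus-≡𝟙-below d m m<d = trans (cong (λ z → 𝟙 m - z) (mono-off d m (ℕP.<⇒≢ m<d))) (ℤP.+-identityʳ (𝟙 m))

geom-≡𝟙-below : ∀ d → geom d ≡𝟙-below d
geom-≡𝟙-below d m = geom-below

Convergent-oneMinus : ∀ j .{{_ : ℕ.NonZero j}} → Convergent (λ n → oneMinus (j ℕ.* n))
Convergent-oneMinus j n = ≡𝟙-below-≤ (ℕP.m≤n*m n j) (oneMinus-≡𝟙-below (j ℕ.* n))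

Convergent-geom : ∀ j .{{_ : ℕ.NonZero j}} → Convergent (λ n → geom (j ℕ.* n))
Convergent-geom j n = ≡𝟙-below-≤ (ℕP.m≤n*m n j) (geom-≡𝟙-below (j ℕ.* n))

-- The factors of f₁²f₂/f₄ and of Φ f₁

≈-absorb : ∀ V c {A} → A ≈ 1ˢ → V ⊕ c ⊛ (A ⊕ ⊖ 1ˢ) ≈ V
≈-absorb V c A≈1 = ≈-trans (⊕-congˡ V (⊛-congˡ c (⊕-congʳ (⊖ 1ˢ) A≈1)))
  (solve 2 (λ V c → V :+ c :* (con (+ 1) :+ :- con (+ 1)) := V) ≈-refl V c)

-- G₂ and G₄ play 1/(1 - x²) and 1/(1 - x⁴).
square-factor-≡ : ∀ x G₂ G₄ → (1ˢ ⊕ ⊖ (x ⊛ x)) ⊛ G₂ ≈ 1ˢ → (1ˢ ⊕ ⊖ (x ⊛ x ⊛ x ⊛ x)) ⊛ G₄ ≈ 1ˢ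
  → (1ˢ ⊕ ⊖ x) ⊛ (1ˢ ⊕ ⊖ x) ⊛ (1ˢ ⊕ ⊖ (x ⊛ x)) ⊛ G₄ ≡ 1ˢ ⊕ 2ˢ ⊛ (x ⊛ G₂) mod 4
square-factor-≡ x G₂ G₄ A₂≈1 A₄≈1 = ≈+multiple⇒≡mod 4 W
  (≈-trans expand (≈-trans (≈-absorb (V ⊕ c₂ ⊛ (A₂ ⊕ ⊖ 1ˢ)) c₄ A₄≈1) (≈-absorb V c₂ A₂≈1)))
  where
  W = x ⊛ x ⊛ x ⊛ G₄ ⊕ ⊖ (x ⊛ G₂)
  V = 1ˢ ⊕ 2ˢ ⊛ (x ⊛ G₂) ⊕ cst (+ 4) ⊛ W
  A₂ = (1ˢ ⊕ ⊖ (x ⊛ x)) ⊛ G₂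
  c₂ = 2ˢ ⊛ x ⊛ (1ˢ ⊕ x ⊛ x) ⊛ G₄
  c₄ = 1ˢ ⊕ ⊖ (2ˢ ⊛ x ⊛ G₂)
  expand = solve 3 (λ x G₂ G₄ →
      (con (+ 1) :+ :- x) :* (con (+ 1) :+ :- x) :* (con (+ 1) :+ :- (x :* x)) :* G₄
    := ((con (+ 1) :+ con (+ 2) :* (x :* G₂)) :+ con (+ 4) :* (x :* x :* x :* G₄ :+ :- (x :* G₂)))
       :+ con (+ 2) :* x :* (con (+ 1) :+ x :* x) :* G₄ :* ((con (+ 1) :+ :- (x :* x)) :* G₂ :+ :- con (+ 1))
       :+ (con (+ 1) :+ :- (con (+ 2) :* x :* G₂))
          :* ((con (+ 1) :+ :- (x :* x :* x :* x)) :* G₄ :+ :- con (+ 1)))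
    ≈-refl x G₂ G₄

-- In both lemmas x plays qⁿ and 2c or 2c + 1 plays n, so that Φ(1 - qⁿ) = 1 - qⁿ - 2n qⁿ.
Φ-factor-even : ∀ x c → 1ˢ ⊕ ⊖ x ⊕ ⊖ (2ˢ ⊛ (c ⊛ 2ˢ ⊛ x)) ≡ 1ˢ ⊕ ⊖ x mod 4
Φ-factor-even x c = ≈+multiple⇒≡mod 4 (⊖ (c ⊛ x)) (solve 2 (λ x c →
      con (+ 1) :+ :- x :+ :- (con (+ 2) :* (c :* con (+ 2) :* x))
    := con (+ 1) :+ :- x :+ con (+ 4) :* (:- (c :* x))) ≈-refl x c)

-- G plays 1/(1 - x).
Φ-factor-odd : ∀ x G c → (1ˢ ⊕ ⊖ x) ⊛ G ≈ 1ˢ →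
  (1ˢ ⊕ ⊖ x ⊕ ⊖ (2ˢ ⊛ ((c ⊛ 2ˢ ⊕ 1ˢ) ⊛ x))) ⊛ (1ˢ ⊕ 2ˢ ⊛ (x ⊛ G)) ≡ 1ˢ ⊕ ⊖ x mod 4
Φ-factor-odd x G c A≈1 = ≈+multiple⇒≡mod 4 W (≈-trans expand (≈-absorb V (2ˢ ⊛ x) A≈1))
  where
  W = ⊖ (c ⊛ x) ⊕ ⊖ ((c ⊛ 2ˢ ⊕ 1ˢ) ⊛ x ⊛ x ⊛ G)
  V = 1ˢ ⊕ ⊖ x ⊕ cst (+ 4) ⊛ W
  expand = solve 3 (λ x G c →
      (con (+ 1) :+ :- x :+ :- (con (+ 2) :* ((c :* con (+ 2) :+ con (+ 1)) :* x)))
        :* (con (+ 1) :+ con (+ 2) :* (x :* G))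
    := (con (+ 1) :+ :- x :+ con (+ 4) :* (:- (c :* x) :+ :- ((c :* con (+ 2) :+ con (+ 1)) :* x :* x :* G)))
       :+ con (+ 2) :* x :* ((con (+ 1) :+ :- x) :* G :+ :- con (+ 1)))
    ≈-refl x G c

θ-oneMinus : ∀ d → θ (oneMinus d) ≈ ⊖ (cst (+ d) ⊛ mono d)
θ-oneMinus d = ≈-trans (mk≈ θ-linear) (≈-trans (⊕-cong θ-𝟙 (⊖-cong (θ-mono d)))
  (solve 1 (λ y → con (+ 0) :+ :- y := :- y) ≈-refl (cst (+ d) ⊛ mono d)))
  where
  θ-linear : ∀ m → + m * (𝟙 m - mono d m) ≡ θ 𝟙 m + - θ (mono d) m
  θ-linear m = trans (ℤP.*-distribˡ-+ (+ m) (𝟙 m) (- mono d m))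
                     (cong (λ z → θ 𝟙 m + z) (sym (ℤP.neg-distribʳ-* (+ m) (mono d m))))

Φ-oneMinus : ∀ d → Φ (oneMinus d) ≈ 1ˢ ⊕ ⊖ mono d ⊕ ⊖ (2ˢ ⊛ (cst (+ d) ⊛ mono d))
Φ-oneMinus d = ≈-trans (Φ≈ (oneMinus d)) (≈-trans (⊕-cong (oneMinus≈ d) (⊛-congˡ 2ˢ (θ-oneMinus d)))
  (solve 3 (λ x y t → x :+ t :* (:- y) := x :+ :- (t :* y)) ≈-refl (1ˢ ⊕ ⊖ mono d) (cst (+ d) ⊛ mono d) 2ˢ))

odd-suc-double : ∀ r → OddNat (suc (r ℕ.* 2))
odd-suc-double r 2∣1+2r = contradiction (ℕD.∣1⇒≡1 (ℕD.∣m+n∣m⇒∣n 2∣2r+1 (ℕD.divides r refl))) λ ()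
  where 2∣2r+1 = subst (2 ℕD.∣_) (ℕP.+-comm 1 (r ℕ.* 2)) 2∣1+2r

odd-form : ∀ {n} → OddNat n → Σ ℕ (λ r → n ≡ suc (r ℕ.* 2))
odd-form {zero} n-odd = ⊥-elim (n-odd (ℕD._∣0 2))
odd-form {suc zero} _ = 0 , refl
odd-form {suc (suc n)} n-odd with odd-form {n} (n-odd ∘ ℕD.∣m∣n⇒∣m+n ℕD.∣-refl)
... | r , refl = suc r , refl

aTerm : ℕ → PS
aTerm n = mono n ⊛ geom (2 ℕ.* n)

bTerm : ℕ → PS
bTerm n with 2 ℕD.∣? n
... | yes _ = 0ˢ
... | no _ = mono n ⊛ geom n

mono-2* : ∀ n → mono (2 ℕ.* n) ≈ mono n ⊛ mono n
mono-2* n = ≈-sym (≈-trans (mono-⊛ n n) (≈-reflexive (cong (λ k → mono (n ℕ.+ k)) (sym (ℕP.+-identityʳ n)))))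

mono-4* : ∀ n → mono (4 ℕ.* n) ≈ mono n ⊛ mono n ⊛ mono n ⊛ mono n
mono-4* n = ≈-sym (≈-trans (⊛-congʳ x (⊛-congʳ x (mono-⊛ n n)))
  (≈-trans (⊛-congʳ x (mono-⊛ (n ℕ.+ n) n)) (≈-trans (mono-⊛ (n ℕ.+ n ℕ.+ n) n) (≈-reflexive (cong mono (four-times n))))))
  where
  x = mono n
  four-times : ∀ n → n ℕ.+ n ℕ.+ n ℕ.+ n ≡ 4 ℕ.* n
  four-times = ℕSolver.solve-∀

f₁²f₂/f₄-factor : ∀ n .{{_ : ℕ.NonZero n}} →
  oneMinus n ⊛ oneMinus n ⊛ oneMinus (2 ℕ.* n) ⊛ geom (4 ℕ.* n) ≡ 1ˢ ⊕ 2ˢ ⊛ aTerm n mod 4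
f₁²f₂/f₄-factor n = ≡mod-trans
  (≈⇒≡mod (⊛-congʳ G₄ (⊛-cong (⊛-cong (oneMinus≈ n) (oneMinus≈ n)) 1-x²≈)))
  (square-factor-≡ x G₂ G₄
    (≈-trans (⊛-congʳ G₂ (≈-sym 1-x²≈)) (oneMinus⊛geom (2 ℕ.* n) {{ℕP.m*n≢0 2 n}}))
    (≈-trans (⊛-congʳ G₄ (≈-sym 1-x⁴≈)) (oneMinus⊛geom (4 ℕ.* n) {{ℕP.m*n≢0 4 n}})))
  where
  x = mono n
  G₂ = geom (2 ℕ.* n)
  G₄ = geom (4 ℕ.* n)
  1-x²≈ : oneMinus (2 ℕ.* n) ≈ 1ˢ ⊕ ⊖ (x ⊛ x)
  1-x²≈ = ≈-trans (oneMinus≈ (2 ℕ.* n)) (⊕-congˡ 1ˢ (⊖-cong (mono-2* n)))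
  1-x⁴≈ : oneMinus (4 ℕ.* n) ≈ 1ˢ ⊕ ⊖ (x ⊛ x ⊛ x ⊛ x)
  1-x⁴≈ = ≈-trans (oneMinus≈ (4 ℕ.* n)) (⊕-congˡ 1ˢ (⊖-cong (mono-4* n)))

Φ-oneMinus-factor : ∀ n → Φ (oneMinus n) ⊛ (1ˢ ⊕ 2ˢ ⊛ bTerm n) ≡ oneMinus n mod 4
Φ-oneMinus-factor n with 2 ℕD.∣? n
... | yes (ℕD.divides r refl) = begin
  Φ (oneMinus d) ⊛ (1ˢ ⊕ 2ˢ ⊛ 0ˢ)
    ≈⟨ ≈⇒≡mod (solve 1 (λ P → P :* (con (+ 1) :+ con (+ 2) :* con (+ 0)) := P) ≈-refl (Φ (oneMinus d))) ⟩
  Φ (oneMinus d)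
    ≈⟨ ≈⇒≡mod (≈-trans (Φ-oneMinus d) (⊕-congˡ (1ˢ ⊕ ⊖ x) (⊖-cong (⊛-congˡ 2ˢ (⊛-congʳ x d≈))))) ⟩
  1ˢ ⊕ ⊖ x ⊕ ⊖ (2ˢ ⊛ (cst (+ r) ⊛ 2ˢ ⊛ x))
    ≈⟨ Φ-factor-even x (cst (+ r)) ⟩
  1ˢ ⊕ ⊖ x
    ≈⟨ ≈⇒≡mod (≈-sym (oneMinus≈ d)) ⟩
  oneMinus d ∎
  where
  open ≡mod-Reasoning 4
  d = r ℕ.* 2
  x = mono d
  d≈ : cst (+ d) ≈ cst (+ r) ⊛ 2ˢ
  d≈ = ≈-trans (mk≈ (λ m → cong (λ z → z * 𝟙 m) (ℤP.pos-* r 2))) (cst-* (+ r) (+ 2))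
... | no n-odd with odd-form n-odd
...   | r , refl = begin
  Φ (oneMinus d) ⊛ (1ˢ ⊕ 2ˢ ⊛ (x ⊛ G))
    ≈⟨ ≈⇒≡mod (⊛-congʳ (1ˢ ⊕ 2ˢ ⊛ (x ⊛ G))
         (≈-trans (Φ-oneMinus d) (⊕-congˡ (1ˢ ⊕ ⊖ x) (⊖-cong (⊛-congˡ 2ˢ (⊛-congʳ x d≈)))))) ⟩
  (1ˢ ⊕ ⊖ x ⊕ ⊖ (2ˢ ⊛ ((cst (+ r) ⊛ 2ˢ ⊕ 1ˢ) ⊛ x))) ⊛ (1ˢ ⊕ 2ˢ ⊛ (x ⊛ G))
    ≈⟨ Φ-factor-odd x G (cst (+ r)) (≈-trans (⊛-congʳ G (≈-sym (oneMinus≈ d))) (oneMinus⊛geom d)) ⟩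
  1ˢ ⊕ ⊖ x
    ≈⟨ ≈⇒≡mod (≈-sym (oneMinus≈ d)) ⟩
  oneMinus d ∎
  where
  open ≡mod-Reasoning 4
  d = suc (r ℕ.* 2)
  x = mono d
  G = geom d
  d≈ : cst (+ d) ≈ cst (+ r) ⊛ 2ˢ ⊕ 1ˢ
  d≈ = ≈-trans (mk≈ (λ m → cong (λ z → z * 𝟙 m) (trans (cong +_ (ℕP.+-comm 1 (r ℕ.* 2)))
                                                   (trans (ℤP.pos-+ (r ℕ.* 2) 1) (cong (_+ + 1) (ℤP.pos-* r 2))))))
               (≈-trans (cst-+ (+ r * + 2) (+ 1)) (⊕-congʳ 1ˢ (cst-* (+ r) (+ 2))))

partialSum : (ℕ → PS) → ℕ → PS
partialSum a zero = 0ˢ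
partialSum a (suc N) = partialSum a N ⊕ a (suc N)

-- a 1 + a 2 + ⋯, truncated like Π; this is the true sum when a n = O(qⁿ).
Σ∞ : (ℕ → PS) → PS
Σ∞ a m = partialSum a m m

1+2·-coeff : ∀ X m → (1ˢ ⊕ 2ˢ ⊛ X) m ≡ 1ˢ m + + 2 * X m
1+2·-coeff X m = cong (λ z → 1ˢ m + z) (sym (at (·≈cst⊛ (+ 2) X) m))

-- (1 + 2a)(1 + 2b) = 1 + 2(a + b) + 4ab.
Π-1+2· : ∀ a → Π (λ n → 1ˢ ⊕ 2ˢ ⊛ a n) ≡ 1ˢ ⊕ 2ˢ ⊛ Σ∞ a mod 4
Π-1+2· a = mk≡mod (mk∣ˢ λ m → subst (λ z → + 4 ℤD.∣ prodUpTo m (λ n → 1ˢ ⊕ 2ˢ ⊛ a n) m - z)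
    (trans (1+2·-coeff (partialSum a m) m) (sym (1+2·-coeff (Σ∞ a) m)))
    (∣-at (∣-difference (prodUpTo-1+2· m)) m))
  where
  prodUpTo-1+2· : ∀ N → prodUpTo N (λ n → 1ˢ ⊕ 2ˢ ⊛ a n) ≡ 1ˢ ⊕ 2ˢ ⊛ partialSum a N mod 4
  prodUpTo-1+2· zero = ≈⇒≡mod (≈-trans 𝟙≈1ˢ (solve 1 (λ t → con (+ 1) := con (+ 1) :+ t :* con (+ 0)) ≈-refl 2ˢ))
  prodUpTo-1+2· (suc N) = ≡mod-trans (≡mod-⊛ (prodUpTo-1+2· N) (≡mod-refl {X = 1ˢ ⊕ 2ˢ ⊛ a (suc N)}))
    (≈+multiple⇒≡mod 4 (s ⊛ a (suc N)) (solve 2 (λ s b →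
        (con (+ 1) :+ con (+ 2) :* s) :* (con (+ 1) :+ con (+ 2) :* b)
      := (con (+ 1) :+ con (+ 2) :* (s :+ b)) :+ con (+ 4) :* (s :* b)) ≈-refl s (a (suc N))))
    where s = partialSum a N

partialSum-cong : ∀ N {a b : ℕ → PS} {m m′} →
  (∀ n → 1 ℕ.≤ n → n ℕ.≤ N → a n m ≡ b n m′) → partialSum a N m ≡ partialSum b N m′
partialSum-cong zero e = refl
partialSum-cong (suc N) e =
  cong₂ _+_ (partialSum-cong N (λ n 1≤n n≤N → e n 1≤n (ℕP.m≤n⇒m≤1+n n≤N))) (e (suc N) (ℕ.s≤s ℕ.z≤n) ℕP.≤-refl)

partialSum-extend : ∀ d N (a : ℕ → PS) m → (∀ n → N ℕ.< n → a n m ≡ + 0) → partialSum a (d ℕ.+ N) m ≡ partialSum a N m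
partialSum-extend zero N a m _ = refl
partialSum-extend (suc d) N a m a≡0 = trans
  (cong₂ _+_ (partialSum-extend d N a m a≡0) (a≡0 (suc (d ℕ.+ N)) (ℕ.s≤s (ℕP.m≤n+m N d))))
  (ℤP.+-identityʳ _)

partialSum-evens : ∀ K (a : ℕ → PS) m → (∀ r → a (suc (r ℕ.* 2)) m ≡ + 0) →
  partialSum a (K ℕ.* 2) m ≡ partialSum (λ n → a (n ℕ.* 2)) K m
partialSum-evens zero a m _ = refl
partialSum-evens (suc K) a m a≡0 = cong (_+ a (suc K ℕ.* 2) m)
  (trans (cong (λ z → partialSum a (K ℕ.* 2) m + z) (a≡0 K))
         (trans (ℤP.+-identityʳ _) (partialSum-evens K a m a≡0)))

-- Σₙ qⁿ/(1 - q²ⁿ) = Σ_{n odd} qⁿ/(1 - qⁿ): both count the odd divisors of each exponent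

odd∣double⇒∣ : ∀ {n k} → OddNat n → n ℕD.∣ k ℕ.* 2 → n ℕD.∣ k
odd∣double⇒∣ {n} {k} n-odd (ℕD.divides t k*2≡t*n)
  with euclidsLemma t n prime[2] (subst (2 ℕD.∣_) k*2≡t*n (ℕD.divides k refl))
... | inj₂ 2∣n = ⊥-elim (n-odd 2∣n)
... | inj₁ (ℕD.divides u refl) = ℕD.divides u (ℕP.*-cancelʳ-≡ k (u ℕ.* n) 2 (trans k*2≡t*n (swap u n)))
  where
  swap : ∀ u n → u ℕ.* 2 ℕ.* n ≡ u ℕ.* n ℕ.* 2
  swap = ℕSolver.solve-∀

mono⊛geom-coeff : ∀ n .{{_ : ℕ.NonZero n}} M → 1 ℕ.≤ M → (mono n ⊛ geom n) M ≡ geom n M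
mono⊛geom-coeff n M 1≤M with splitAt n M
... | below M<n = trans (mono⊛-below n (geom n) M M<n)
                        (sym (geom-∤ (λ n∣M → ℕP.<⇒≱ M<n (ℕD.∣⇒≤ {{ℕ.>-nonZero 1≤M}} n∣M))))
... | above j refl = trans (mono⊛-above n (geom n) j) (sym (geom-periodic n j))

bTerm-even : ∀ {n} → 2 ℕD.∣ n → ∀ M → bTerm n M ≡ + 0
bTerm-even {n} 2∣n M with 2 ℕD.∣? n
... | yes _ = refl
... | no n-odd = ⊥-elim (n-odd 2∣n)

bTerm-odd : ∀ {n} → OddNat n → ∀ M → 1 ℕ.≤ M → bTerm n M ≡ geom n M
bTerm-odd {n} n-odd M 1≤M with 2 ℕD.∣? n
... | yes 2∣n = ⊥-elim (n-odd 2∣n)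
... | no _ = mono⊛geom-coeff n {{ℕ.≢-nonZero (λ { refl → n-odd (ℕD._∣0 2) })}} M 1≤M

aTerm-coeff : ∀ n .{{_ : ℕ.NonZero n}} M → aTerm n M ≡ geom (2 ℕ.* n) (n ℕ.+ M)
aTerm-coeff n M with splitAt n M
... | below M<n = trans (mono⊛-below n (geom (2 ℕ.* n)) M M<n)
  (trans (sym (𝟙-suc (ℕ.>-nonZero⁻¹ n))) (sym (geom-below (subst (n ℕ.+ M ℕ.<_) (sym (two-times n)) (ℕP.+-monoʳ-< n M<n)))))
  where
  two-times : ∀ n → 2 ℕ.* n ≡ n ℕ.+ n
  two-times = ℕSolver.solve-∀
  𝟙-suc : 0 ℕ.< n → 𝟙 (n ℕ.+ M) ≡ + 0
  𝟙-suc (ℕ.s≤s _) = refl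
... | above j refl = trans (mono⊛-above n (geom (2 ℕ.* n)) j)
  (sym (trans (cong (geom (2 ℕ.* n)) (regroup n j)) (geom-periodic (2 ℕ.* n) j)))
  where
  regroup : ∀ n j → n ℕ.+ (n ℕ.+ j) ≡ 2 ℕ.* n ℕ.+ j
  regroup = ℕSolver.solve-∀

aTerm≡bTerm-at-odd : ∀ {M} → OddNat M → ∀ n .{{_ : ℕ.NonZero n}} → aTerm n M ≡ bTerm n M
aTerm≡bTerm-at-odd {M} M-odd n with 2 ℕD.∣? n
... | yes 2∣n = trans (aTerm-coeff n M) (geom-∤ λ 2n∣n+M →
  M-odd (ℕD.∣m+n∣m⇒∣n (ℕD.∣-trans (ℕD.m∣m*n n) 2n∣n+M) 2∣n))
... | no n-odd = trans (aTerm-coeff n M) (trans (geom-cong to from) (sym (mono⊛geom-coeff n M 1≤M)))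
  where
  1≤M : 1 ℕ.≤ M
  1≤M = ℕ.>-nonZero⁻¹ M {{ℕ.≢-nonZero (λ { refl → M-odd (ℕD._∣0 2) })}}
  to : 2 ℕ.* n ℕD.∣ n ℕ.+ M → n ℕD.∣ M
  to 2n∣n+M = ℕD.∣m+n∣m⇒∣n (ℕD.∣-trans (ℕD.n∣m*n 2) 2n∣n+M) ℕD.∣-refl
  -- M = t n with t odd, so n + M = (1 + t) n is a multiple of 2n.
  from : n ℕD.∣ M → 2 ℕ.* n ℕD.∣ n ℕ.+ M
  from (ℕD.divides t refl) with odd-form {t} (λ 2∣t → M-odd (ℕD.∣m⇒∣m*n n 2∣t))
  ... | s , refl = ℕD.divides (suc s) (regroup s n)
    where
    regroup : ∀ s n → n ℕ.+ suc (s ℕ.* 2) ℕ.* n ≡ suc s ℕ.* (2 ℕ.* n)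
    regroup = ℕSolver.solve-∀

Σ∞-aTerm-double : ∀ k → Σ∞ aTerm (k ℕ.* 2) ≡ Σ∞ aTerm k
Σ∞-aTerm-double k = trans (partialSum-evens k aTerm (k ℕ.* 2) odd-terms-vanish)
  (partialSum-cong k (λ n 1≤n _ → halve n {{ℕ.>-nonZero 1≤n}}))
  where
  odd-terms-vanish : ∀ r → aTerm (suc (r ℕ.* 2)) (k ℕ.* 2) ≡ + 0
  odd-terms-vanish r = trans (aTerm-coeff (suc (r ℕ.* 2)) (k ℕ.* 2)) (geom-∤ λ 2n∣n+2k →
    odd-suc-double r (ℕD.∣m+n∣m⇒∣n (subst (2 ℕD.∣_) (ℕP.+-comm (suc (r ℕ.* 2)) (k ℕ.* 2))
      (ℕD.∣-trans (ℕD.m∣m*n (suc (r ℕ.* 2))) 2n∣n+2k)) (ℕD.divides k refl)))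
  4n≡2[2n] : ∀ n → 2 ℕ.* (n ℕ.* 2) ≡ 2 ℕ.* (2 ℕ.* n)
  4n≡2[2n] = ℕSolver.solve-∀
  2n+2k≡2[n+k] : ∀ n k → n ℕ.* 2 ℕ.+ k ℕ.* 2 ≡ 2 ℕ.* (n ℕ.+ k)
  2n+2k≡2[n+k] = ℕSolver.solve-∀
  halve : ∀ n .{{_ : ℕ.NonZero n}} → aTerm (n ℕ.* 2) (k ℕ.* 2) ≡ aTerm n k
  halve n = trans (aTerm-coeff (n ℕ.* 2) {{ℕP.m*n≢0 n 2}} (k ℕ.* 2)) (trans (geom-cong
      (λ 4n∣2[n+k] → ℕD.*-cancelˡ-∣ 2 (subst₂ ℕD._∣_ (4n≡2[2n] n) (2n+2k≡2[n+k] n k) 4n∣2[n+k]))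
      (λ 2n∣n+k → subst₂ ℕD._∣_ (sym (4n≡2[2n] n)) (sym (2n+2k≡2[n+k] n k)) (ℕD.*-monoʳ-∣ 2 2n∣n+k)))
    (sym (aTerm-coeff n k)))

Σ∞-bTerm-double : ∀ k → 1 ℕ.≤ k → Σ∞ bTerm (k ℕ.* 2) ≡ Σ∞ bTerm k
Σ∞-bTerm-double k 1≤k = begin
  partialSum bTerm (k ℕ.* 2) (k ℕ.* 2)    ≡⟨ cong (λ N → partialSum bTerm N (k ℕ.* 2)) (double k) ⟩
  partialSum bTerm (k ℕ.+ k) (k ℕ.* 2)    ≡⟨ partialSum-extend k k bTerm (k ℕ.* 2) large-terms-vanish ⟩
  partialSum bTerm k (k ℕ.* 2)            ≡⟨ partialSum-cong k (λ n _ _ → halve n) ⟩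
  partialSum bTerm k k ∎
  where
  open ≡-Reasoning
  double : ∀ k → k ℕ.* 2 ≡ k ℕ.+ k
  double = ℕSolver.solve-∀
  1≤2k : 1 ℕ.≤ k ℕ.* 2
  1≤2k = ℕP.≤-trans 1≤k (ℕP.m≤m*n k 2)
  large-terms-vanish : ∀ n → k ℕ.< n → bTerm n (k ℕ.* 2) ≡ + 0
  large-terms-vanish n k<n with toSum (2 ℕD.∣? n)
  ... | inj₁ 2∣n = bTerm-even 2∣n (k ℕ.* 2)
  ... | inj₂ n-odd = trans (bTerm-odd n-odd (k ℕ.* 2) 1≤2k)
    (geom-∤ λ n∣2k → ℕP.<⇒≱ k<n (ℕD.∣⇒≤ {{ℕ.>-nonZero 1≤k}} (odd∣double⇒∣ n-odd n∣2k)))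
  halve : ∀ n → bTerm n (k ℕ.* 2) ≡ bTerm n k
  halve n with toSum (2 ℕD.∣? n)
  ... | inj₁ 2∣n = trans (bTerm-even 2∣n (k ℕ.* 2)) (sym (bTerm-even 2∣n k))
  ... | inj₂ n-odd = trans (bTerm-odd n-odd (k ℕ.* 2) 1≤2k)
    (trans (geom-cong (odd∣double⇒∣ n-odd) (ℕD.∣m⇒∣m*n 2)) (sym (bTerm-odd n-odd k 1≤k)))

Σ∞-aTerm≈Σ∞-bTerm : Σ∞ aTerm ≈ Σ∞ bTerm
Σ∞-aTerm≈Σ∞-bTerm = mk≈ (<-rec (λ M → Σ∞ aTerm M ≡ Σ∞ bTerm M) go)
  where
  go : ∀ M → (∀ {M′} → M′ ℕ.< M → Σ∞ aTerm M′ ≡ Σ∞ bTerm M′) → Σ∞ aTerm M ≡ Σ∞ bTerm M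
  go M ih with 2 ℕD.∣? M
  ... | no M-odd = partialSum-cong M (λ n 1≤n _ → aTerm≡bTerm-at-odd M-odd n {{ℕ.>-nonZero 1≤n}})
  ... | yes (ℕD.divides zero refl) = refl
  ... | yes (ℕD.divides (suc k) refl) = trans (Σ∞-aTerm-double (suc k))
    (trans (ih (ℕP.m<m*n (suc k) 2 ℕP.≤-refl)) (sym (Σ∞-bTerm-double (suc k) (ℕ.s≤s ℕ.z≤n))))

-- The key congruence f₁ · f₁²f₂/f₄ ≡ Φ f₁ (mod 4)

f₁≈Π : f 1 ≈ Π oneMinus
f₁≈Π = Π-cong (λ n → mk≈ (λ m → cong (λ d → oneMinus d m) (ℕP.*-identityˡ (suc n))))

finv₁≈Π : finv 1 ≈ Π geom
finv₁≈Π = Π-cong (λ n → mk≈ (λ m → cong (λ d → geom d m) (ℕP.*-identityˡ (suc n))))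

f₁⊛finv₁ : f 1 ⊛ finv 1 ≈ 1ˢ
f₁⊛finv₁ = ≈-trans (⊛-cong f₁≈Π finv₁≈Π) (≈-trans (≈-sym (Π-⊛ oneMinus-≡𝟙-below geom-≡𝟙-below))
  (≈-trans (Π-cong {G = λ _ → 𝟙} (λ n → ≈-trans (oneMinus⊛geom (suc n)) (≈-sym 𝟙≈1ˢ))) (≈-trans Π-𝟙 𝟙≈1ˢ)))

f₁²f₂/f₄≡ : f 1 ⊛ f 1 ⊛ f 2 ⊛ finv 4 ≡ 1ˢ ⊕ 2ˢ ⊛ Σ∞ aTerm mod 4
f₁²f₂/f₄≡ = begin
  f 1 ⊛ f 1 ⊛ f 2 ⊛ finv 4
    ≈⟨ ≈⇒≡mod (⊛-congʳ (finv 4) (⊛-congʳ (f 2) (⊛-cong f₁≈Π f₁≈Π))) ⟩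
  Π oneMinus ⊛ Π oneMinus ⊛ f 2 ⊛ finv 4
    ≈⟨ ≈⇒≡mod (≈-sym (≈-trans (Π-⊛ (Convergent-⊛ (Convergent-⊛ c₁ c₁) c₂) c₄)
                (⊛-congʳ (finv 4) (≈-trans (Π-⊛ (Convergent-⊛ c₁ c₁) c₂) (⊛-congʳ (f 2) (Π-⊛ c₁ c₁)))))) ⟩
  Π (λ n → oneMinus n ⊛ oneMinus n ⊛ oneMinus (2 ℕ.* n) ⊛ geom (4 ℕ.* n))
    ≈⟨ Π-≡mod (λ n → f₁²f₂/f₄-factor (suc n)) ⟩
  Π (λ n → 1ˢ ⊕ 2ˢ ⊛ aTerm n)
    ≈⟨ Π-1+2· aTerm ⟩
  1ˢ ⊕ 2ˢ ⊛ Σ∞ aTerm ∎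
  where
  open ≡mod-Reasoning 4
  c₁ = oneMinus-≡𝟙-below
  c₂ = Convergent-oneMinus 2
  c₄ = Convergent-geom 4

bTerm-below : ∀ n m → m ℕ.< n → bTerm n m ≡ + 0
bTerm-below n m m<n with 2 ℕD.∣? n
... | yes _ = refl
... | no _ = mono⊛-below n (geom n) m m<n

1+2·-≡𝟙-below : ∀ {n X} → (∀ m → m ℕ.< n → X m ≡ + 0) → 1ˢ ⊕ 2ˢ ⊛ X ≡𝟙-below n
1+2·-≡𝟙-below {n} {X} X≡0 m m<n = begin
  (1ˢ ⊕ 2ˢ ⊛ X) m    ≡⟨ 1+2·-coeff X m ⟩
  1ˢ m + + 2 * X m    ≡⟨ cong (λ z → 1ˢ m + + 2 * z) (X≡0 m m<n) ⟩
  1ˢ m + + 0          ≡⟨ ℤP.+-identityʳ (1ˢ m) ⟩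
  1ˢ m                ≡⟨ sym (at 𝟙≈1ˢ m) ⟩
  𝟙 m ∎
  where open ≡-Reasoning

Φf₁⊛[1+2Σ∞bTerm]≡f₁ : Φ (f 1) ⊛ (1ˢ ⊕ 2ˢ ⊛ Σ∞ bTerm) ≡ f 1 mod 4
Φf₁⊛[1+2Σ∞bTerm]≡f₁ = begin
  Φ (f 1) ⊛ (1ˢ ⊕ 2ˢ ⊛ Σ∞ bTerm)
    ≈⟨ ≡mod-⊛ (≡mod-trans (≈⇒≡mod (Φ-cong f₁≈Π)) (Π-Φ oneMinus)) (≡mod-sym (Π-1+2· bTerm)) ⟩
  Π (Φ ∘ oneMinus) ⊛ Π (λ n → 1ˢ ⊕ 2ˢ ⊛ bTerm n)
    ≈⟨ ≈⇒≡mod (≈-sym (Π-⊛ (λ n → ≡𝟙-below-Φ (oneMinus-≡𝟙-below n)) (λ n → 1+2·-≡𝟙-below (bTerm-below n)))) ⟩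
  Π (λ n → Φ (oneMinus n) ⊛ (1ˢ ⊕ 2ˢ ⊛ bTerm n))
    ≈⟨ Π-≡mod (λ n → Φ-oneMinus-factor (suc n)) ⟩
  Π oneMinus
    ≈⟨ ≈⇒≡mod (≈-sym f₁≈Π) ⟩
  f 1 ∎
  where open ≡mod-Reasoning 4

-- (1 + 2s)² ≡ 1, so by the previous lemma Φ f₁ ≡ f₁ (1 + 2 Σ∞ bTerm), and Σ∞ bTerm = Σ∞ aTerm.
f₁⊛f₁²f₂/f₄≡Φf₁ : f 1 ⊛ (f 1 ⊛ f 1 ⊛ f 2 ⊛ finv 4) ≡ Φ (f 1) mod 4
f₁⊛f₁²f₂/f₄≡Φf₁ = begin
  f 1 ⊛ (f 1 ⊛ f 1 ⊛ f 2 ⊛ finv 4)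
    ≈⟨ ≡mod-⊛ (≡mod-refl {X = f 1}) f₁²f₂/f₄≡ ⟩
  f 1 ⊛ (1ˢ ⊕ 2ˢ ⊛ Σ∞ aTerm)
    ≈⟨ ≈⇒≡mod (⊛-congˡ (f 1) (⊕-congˡ 1ˢ (⊛-congˡ 2ˢ Σ∞-aTerm≈Σ∞-bTerm))) ⟩
  f 1 ⊛ u
    ≈⟨ ≡mod-⊛ (≡mod-sym Φf₁⊛[1+2Σ∞bTerm]≡f₁) (≡mod-refl {X = u}) ⟩
  Φ (f 1) ⊛ u ⊛ u
    ≈⟨ ≈+multiple⇒≡mod 4 (Φ (f 1) ⊛ (s ⊕ s ⊛ s)) (solve 2 (λ P s →
         P :* (con (+ 1) :+ con (+ 2) :* s) :* (con (+ 1) :+ con (+ 2) :* s)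
         := P :+ con (+ 4) :* (P :* (s :+ s :* s))) ≈-refl (Φ (f 1)) s) ⟩
  Φ (f 1) ∎
  where
  open ≡mod-Reasoning 4
  s = Σ∞ bTerm
  u = 1ˢ ⊕ 2ˢ ⊛ s

-- Series fixed by Φ modulo 4

Φ-Invariant : PS → Set
Φ-Invariant X = Φ X ≡ X mod 4

Φ-Invariant-resp-≈ : ∀ {X Y} → X ≈ Y → Φ-Invariant X → Φ-Invariant Y
Φ-Invariant-resp-≈ X≈Y X-inv = ≡mod-trans (≈⇒≡mod (Φ-cong (≈-sym X≈Y))) (≡mod-trans X-inv (≈⇒≡mod X≈Y))

Φ-Invariant-⊛ : ∀ {X Y} → Φ-Invariant X → Φ-Invariant Y → Φ-Invariant (X ⊛ Y)
Φ-Invariant-⊛ {X} {Y} X-inv Y-inv = ≡mod-trans (Φ-⊛ X Y) (≡mod-⊛ X-inv Y-inv)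

Φ-Invariant-square : ∀ Y → Φ-Invariant (Y ⊛ Y)
Φ-Invariant-square Y = ≡mod-trans (Φ-⊛ Y Y) (≈+multiple⇒≡mod 4 (Y ⊛ θ Y ⊕ θ Y ⊛ θ Y)
  (≈-trans (⊛-cong (Φ≈ Y) (Φ≈ Y)) (solve 2 (λ Y D →
      (Y :+ con (+ 2) :* D) :* (Y :+ con (+ 2) :* D) := Y :* Y :+ con (+ 4) :* (Y :* D :+ D :* D))
    ≈-refl Y (θ Y))))

SupportedOnMultiplesOf : ℕ → PS → Set
SupportedOnMultiplesOf j X = ∀ m → ¬ j ℕD.∣ m → X m ≡ + 0

-- θX has coefficients m Xₘ, so 2θX ≡ 0 (mod 4) when only even m occur.
Φ-Invariant-even : ∀ {X} → SupportedOnMultiplesOf 2 X → Φ-Invariant X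
Φ-Invariant-even {X} X-even = mk≡mod (mk∣ˢ λ m → go m)
  where
  go : ∀ m → + 4 ℤD.∣ Φ X m - X m
  go m with 2 ℕD.∣? m
  ... | yes (ℕD.divides t refl) = ℤD.divides (+ t * X (t ℕ.* 2)) (begin
    X (t ℕ.* 2) + + 2 * (+ (t ℕ.* 2) * X (t ℕ.* 2)) - X (t ℕ.* 2)
      ≡⟨ cong (λ z → X (t ℕ.* 2) + + 2 * (z * X (t ℕ.* 2)) - X (t ℕ.* 2)) (ℤP.pos-* t 2) ⟩
    X (t ℕ.* 2) + + 2 * (+ t * + 2 * X (t ℕ.* 2)) - X (t ℕ.* 2)
      ≡⟨ collect (X (t ℕ.* 2)) (+ t) ⟩
    + t * X (t ℕ.* 2) * + 4 ∎)
    where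
    open ≡-Reasoning
    collect : ∀ x u → x + + 2 * (u * + 2 * x) - x ≡ u * x * + 4
    collect = solve-∀
  ... | no m-odd = subst (λ z → + 4 ℤD.∣ z + + 2 * (+ m * z) - z) (sym (X-even m m-odd)) (ℤD.divides (+ 0) (vanish (+ m)))
    where
    vanish : ∀ u → + 0 + + 2 * (u * + 0) - + 0 ≡ + 0 * + 4
    vanish = solve-∀

SupportedOnMultiplesOf-⊛ : ∀ {j X Y} → SupportedOnMultiplesOf j X → SupportedOnMultiplesOf j Y →
  SupportedOnMultiplesOf j (X ⊛ Y)
SupportedOnMultiplesOf-⊛ {j} {X} {Y} X-supp Y-supp m j∤m = sumTo-zero m _ term≡0
  where
  term≡0 : ∀ k → k ℕ.≤ m → X k * Y (m ∸ k) ≡ + 0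
  term≡0 k k≤m with j ℕD.∣? k
  ... | yes j∣k = trans (cong (X k *_) (Y-supp (m ∸ k) λ j∣m∸k →
                    j∤m (subst (j ℕD.∣_) (ℕP.m+[n∸m]≡n k≤m) (ℕD.∣m∣n⇒∣m+n j∣k j∣m∸k))))
                  (ℤP.*-zeroʳ (X k))
  ... | no j∤k = trans (cong (_* Y (m ∸ k)) (X-supp k j∤k)) (ℤP.*-zeroˡ (Y (m ∸ k)))

SupportedOnMultiplesOf-𝟙 : ∀ {j} → SupportedOnMultiplesOf j 𝟙
SupportedOnMultiplesOf-𝟙 {j} zero j∤0 = ⊥-elim (j∤0 (ℕD._∣0 j))
SupportedOnMultiplesOf-𝟙 (suc m) _ = refl

SupportedOnMultiplesOf-pow : ∀ {j X} → SupportedOnMultiplesOf j X → ∀ k → SupportedOnMultiplesOf j (pow X k)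
SupportedOnMultiplesOf-pow X-supp zero = SupportedOnMultiplesOf-𝟙
SupportedOnMultiplesOf-pow X-supp (suc k) = SupportedOnMultiplesOf-⊛ (SupportedOnMultiplesOf-pow X-supp k) X-supp

SupportedOnMultiplesOf-Π : ∀ {j F} → (∀ n → SupportedOnMultiplesOf j (F (suc n))) → SupportedOnMultiplesOf j (Π F)
SupportedOnMultiplesOf-Π {j} {F} F-supp m = prodUpTo-supp m m
  where
  prodUpTo-supp : ∀ N → SupportedOnMultiplesOf j (prodUpTo N F)
  prodUpTo-supp zero = SupportedOnMultiplesOf-𝟙
  prodUpTo-supp (suc N) = SupportedOnMultiplesOf-⊛ (prodUpTo-supp N) (F-supp N)

SupportedOnMultiplesOf-fpow : ∀ j e → SupportedOnMultiplesOf j (fpow j e)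
SupportedOnMultiplesOf-fpow j (+ k) = SupportedOnMultiplesOf-pow (SupportedOnMultiplesOf-Π λ n m j∤m →
  trans (cong (λ z → 𝟙 m - z) (mono-off (j ℕ.* suc n) m λ { refl → j∤m (ℕD.m∣m*n (suc n)) }))
        (trans (ℤP.+-identityʳ (𝟙 m)) (SupportedOnMultiplesOf-𝟙 m j∤m))) k
SupportedOnMultiplesOf-fpow j -[1+ k ] = SupportedOnMultiplesOf-pow (SupportedOnMultiplesOf-Π λ n m j∤m →
  geom-∤ (j∤m ∘ ℕD.∣-trans (ℕD.m∣m*n (suc n)))) (suc k)

pow-+ : ∀ X a b → pow X (a ℕ.+ b) ≈ pow X a ⊛ pow X b
pow-+ X zero b = mk≈ (λ m → sym (⊛-identityˡ m (pow X b)))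
pow-+ X (suc a) b = ≈-trans (⊛-congʳ X (pow-+ X a b))
  (solve 3 (λ P Q X → P :* Q :* X := P :* X :* Q) ≈-refl (pow X a) (pow X b) X)

pow-double : ∀ X r → pow X (r ℕ.* 2) ≈ pow X r ⊛ pow X r
pow-double X r = ≈-trans (≈-reflexive (cong (pow X) (double r))) (pow-+ X r r)
  where
  double : ∀ r → r ℕ.* 2 ≡ r ℕ.+ r
  double = ℕSolver.solve-∀

fpow-Φ-Invariant : ∀ j e → (OddNat j → + 2 ∣ e) → Φ-Invariant (fpow j e)
fpow-Φ-Invariant j e j-odd⇒2∣e with 2 ℕD.∣? j
... | yes 2∣j = Φ-Invariant-even (λ m m-odd → SupportedOnMultiplesOf-fpow j e m (m-odd ∘ ℕD.∣-trans 2∣j))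
... | no j-odd with e | j-odd⇒2∣e j-odd
...   | + _ | ℕD.divides r refl = Φ-Invariant-resp-≈ (≈-sym (pow-double (f j) r)) (Φ-Invariant-square (pow (f j) r))
...   | -[1+ _ ] | ℕD.divides r 1+k≡2r = Φ-Invariant-resp-≈
  (≈-sym (≈-trans (mk≈ (λ m → cong (λ k → pow (finv j) k m) 1+k≡2r)) (pow-double (finv j) r)))
  (Φ-Invariant-square (pow (finv j) r))

fpow₁-odd : ∀ e → ¬ (+ 2 ∣ e) → Σ PS (λ K → fpow 1 e ≈ f 1 ⊛ K × Φ-Invariant K)
fpow₁-odd (+ k) 2∤e with odd-form 2∤e
... | r , refl = Y ⊛ Y , ≈-trans (⊛-congʳ (f 1) (pow-double (f 1) r))
  (solve 2 (λ Y F → Y :* Y :* F := F :* (Y :* Y)) ≈-refl Y (f 1)) , Φ-Invariant-square Y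
  where Y = pow (f 1) r
fpow₁-odd -[1+ k ] 2∤e with toSum (2 ℕD.∣? k)
... | inj₂ k-odd with odd-form k-odd
...   | r , refl = ⊥-elim (2∤e (ℕD.divides (suc r) refl))
fpow₁-odd -[1+ k ] 2∤e | inj₁ (ℕD.divides r refl) = K , fpow≈ , Φ-Invariant-square (finv 1 ⊛ Y)
  where
  Y = pow (finv 1) r
  K = (finv 1 ⊛ Y) ⊛ (finv 1 ⊛ Y)
  -- 1/f₁^(2r+1) = f₁ · (1/f₁^(r+1))², using f₁ · (1/f₁) = 1.
  fpow≈ : pow (finv 1) (r ℕ.* 2) ⊛ finv 1 ≈ f 1 ⊛ K
  fpow≈ = ≈-trans (⊛-congʳ (finv 1) (pow-double (finv 1) r))
    (≈-sym (≈-trans (solve 3 (λ F G Y → F :* ((G :* Y) :* (G :* Y))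
                                := Y :* Y :* G :+ (Y :* Y :* G) :* (F :* G :+ :- con (+ 1))) ≈-refl (f 1) (finv 1) Y)
           (≈-absorb (Y ⊛ Y ⊛ finv 1) (Y ⊛ Y ⊛ finv 1) f₁⊛finv₁)))

etaQuotient≈f₁⊛Φ-Invariant : ∀ N (e : ℕ → ℤ) → ¬ (+ 2 ∣ e 1) → (∀ j → 1 ℕ.< j → OddNat j → + 2 ∣ e j)
  → Σ PS (λ K → etaQuotient (suc N) e ≈ f 1 ⊛ K × Φ-Invariant K)
etaQuotient≈f₁⊛Φ-Invariant zero e e₁-odd _ with fpow₁-odd (e 1) e₁-odd
... | K , fpow≈ , K-inv = K , ≈-trans (mk≈ (λ m → ⊛-identityˡ m (fpow 1 (e 1)))) fpow≈ , K-inv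
etaQuotient≈f₁⊛Φ-Invariant (suc N) e e₁-odd eⱼ-even with etaQuotient≈f₁⊛Φ-Invariant N e e₁-odd eⱼ-even
... | K , A≈ , K-inv = K ⊛ F , ≈-trans (⊛-congʳ F A≈) (solve 3 (λ F K G → F :* K :* G := F :* (K :* G)) ≈-refl (f 1) K F)
                      , Φ-Invariant-⊛ K-inv (fpow-Φ-Invariant (2 ℕ.+ N) (e (2 ℕ.+ N)) (eⱼ-even (2 ℕ.+ N) (ℕ.s≤s (ℕ.s≤s ℕ.z≤n))))
  where F = fpow (2 ℕ.+ N) (e (2 ℕ.+ N))

⊛f₁²f₂/f₄≡Φ : ∀ A K → A ≈ f 1 ⊛ K → Φ-Invariant K → A ⊛ f 1 ⊛ f 1 ⊛ f 2 ⊛ finv 4 ≡ Φ A mod 4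
⊛f₁²f₂/f₄≡Φ A K A≈f₁K K-inv = begin
  A ⊛ f 1 ⊛ f 1 ⊛ f 2 ⊛ finv 4
    ≈⟨ ≈⇒≡mod (≈-trans (⊛-congʳ (finv 4) (⊛-congʳ (f 2) (⊛-congʳ (f 1) (⊛-congʳ (f 1) A≈f₁K))))
         (solve 4 (λ F K F₂ G → F :* K :* F :* F :* F₂ :* G := K :* (F :* (F :* F :* F₂ :* G))) ≈-refl
           (f 1) K (f 2) (finv 4))) ⟩
  K ⊛ (f 1 ⊛ (f 1 ⊛ f 1 ⊛ f 2 ⊛ finv 4))
    ≈⟨ ≡mod-⊛ (≡mod-sym K-inv) f₁⊛f₁²f₂/f₄≡Φf₁ ⟩
  Φ K ⊛ Φ (f 1)
    ≈⟨ ≡mod-sym (Φ-⊛ K (f 1)) ⟩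
  Φ (K ⊛ f 1)
    ≈⟨ ≈⇒≡mod (Φ-cong (≈-trans (mk≈ (λ m → ⊛-comm m K (f 1))) (≈-sym A≈f₁K))) ⟩
  Φ A ∎
  where open ≡mod-Reasoning 4

odd-multiple-involutive : ∀ a b m → + 4 ℤD.∣ b - (a + + 2 * (m * a)) → + 4 ℤD.∣ a - (b + + 2 * (m * b))
odd-multiple-involutive a b m b≡a = subst (+ 4 ℤD.∣_) (sym (identity a b m))
  (ℤD.∣m∣n⇒∣m+n (ℤD.∣n⇒∣m*n (- (+ 1 + + 2 * m)) b≡a) (ℤD.∣m⇒∣m*n (- ((m + m * m) * a)) (ℤD.∣-refl {+ 4})))
  where
  identity : ∀ a b m → a - (b + + 2 * (m * b))
                     ≡ - (+ 1 + + 2 * m) * (b - (a + + 2 * (m * a))) + + 4 * - ((m + m * m) * a)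
  identity = solve-∀

odd-multiple-fixes-even : ∀ a b m {c} → + 4 ℤD.∣ b - (a + + 2 * (m * a)) → + 2 ℤD.∣ c → + 4 ℤD.∣ a - c → + 4 ℤD.∣ b - c
odd-multiple-fixes-even a b m b≡a (ℤD.divides t refl) a≡c = subst (+ 4 ℤD.∣_) (sym (identity a b m t))
  (ℤD.∣m∣n⇒∣m+n (ℤD.∣m∣n⇒∣m+n b≡a (ℤD.∣n⇒∣m*n (+ 1 + + 2 * m) a≡c)) (ℤD.∣m⇒∣m*n (m * t) (ℤD.∣-refl {+ 4})))
  where
  identity : ∀ a b m t → b - t * + 2
                       ≡ (b - (a + + 2 * (m * a))) + (+ 1 + + 2 * m) * (a - t * + 2) + + 4 * (m * t)
  identity = solve-∀

mod4-residues : ∀ a b m → + 4 ℤD.∣ b - (a + + 2 * (m * a)) →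
  ((+ 4 ∣ a) ⇔ (+ 4 ∣ b)) × ((+ 4 ∣ a - + 2) ⇔ (+ 4 ∣ b - + 2))
mod4-residues a b m b≡a = mk⇔ (residue₀ a b b≡a) (residue₀ b a a≡b) , mk⇔ (residue₂ a b b≡a) (residue₂ b a a≡b)
  where
  a≡b = odd-multiple-involutive a b m b≡a
  residue₀ : ∀ x y → + 4 ℤD.∣ y - (x + + 2 * (m * x)) → + 4 ∣ x → + 4 ∣ y
  residue₀ x y y≡x 4∣x = ℤD.∣⇒∣ᵤ (subst (+ 4 ℤD.∣_) (ℤP.+-identityʳ y)
    (odd-multiple-fixes-even x y m y≡x (ℤD.divides (+ 0) refl) (subst (+ 4 ℤD.∣_) (sym (ℤP.+-identityʳ x)) (ℤD.∣ᵤ⇒∣ 4∣x))))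
  residue₂ : ∀ x y → + 4 ℤD.∣ y - (x + + 2 * (m * x)) → + 4 ∣ x - + 2 → + 4 ∣ y - + 2
  residue₂ x y y≡x 4∣x-2 = ℤD.∣⇒∣ᵤ (odd-multiple-fixes-even x y m y≡x (ℤD.divides (+ 1) refl) (ℤD.∣ᵤ⇒∣ 4∣x-2))

corollary2p4 : (N : ℕ) (e : ℕ → ℤ)
    → (∀ j → N ℕ.< j → e j ≡ + 0)
    → ¬ (+ 2 ∣ e 1)
    → (∀ j → 1 ℕ.< j → OddNat j → + 2 ∣ e j)
    → ∀ n →
      ((+ 4 ∣ etaQuotient N e n)
        ⇔ (+ 4 ∣ (etaQuotient N e ⊛ f 1 ⊛ f 1 ⊛ f 2 ⊛ finv 4) n))
      × ((+ 4 ∣ (etaQuotient N e n - + 2))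
        ⇔ (+ 4 ∣ ((etaQuotient N e ⊛ f 1 ⊛ f 1 ⊛ f 2 ⊛ finv 4) n - + 2)))
corollary2p4 zero e e-vanishes e₁-odd _ _ = ⊥-elim (e₁-odd (subst (+ 2 ∣_) (sym (e-vanishes 1 ℕP.≤-refl)) (ℕD._∣0 2)))
corollary2p4 (suc N) e _ e₁-odd eⱼ-even n with etaQuotient≈f₁⊛Φ-Invariant N e e₁-odd eⱼ-even
... | K , A≈f₁K , K-inv = mod4-residues (A n) (B n) (+ n) (∣-at (∣-difference (⊛f₁²f₂/f₄≡Φ A K A≈f₁K K-inv)) n)
  where
  A = etaQuotient (suc N) e
  B = A ⊛ f 1 ⊛ f 1 ⊛ f 2 ⊛ finv 4
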